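{- The function $\mathsf{CtoB} : \mathsf{Cnf} \to \mathsf{Brw}$ preserves and reflects $<$ and $\leq$: for all $a, b : \mathsf{Cnf}$, $a < b \iff \mathsf{CtoB}(a) < \mathsf{CtoB}(b)$ and $a \leq b \iff \mathsf{CtoB}(a) \leq \mathsf{CtoB}(b)$.
   Context: Cantor normal forms: $\mathcal{T}$ is the inductive type of binary trees with constructors $0$ and $\mathsf{node}(a,b)$; $<$ on $\mathcal{T}$ is generated by $0 < \mathsf{node}(a,b)$, $a < c \to \mathsf{node}(a,b) < \mathsf{node}(c,d)$, $b < d \to \mathsf{node}(a,b) < \mathsf{node}(a,d)$; $s \leq t := (s<t) \uplus (s=t)$; $\mathsf{left}(0):=0$, $\mathsf{left}(\mathsf{node}(a,b)) := a$; $\mathsf{isCNF}$ is generated by $\mathsf{isCNF}(0)$ and $\mathsf{isCNF}(s)\to\mathsf{isCNF}(t)\to \mathsf{left}(t)\leq s \to \mathsf{isCNF}(\mathsf{node}(s,t))$; $\mathsf{Cnf} := \Sigma(t:\mathcal{T}).\mathsf{isCNF}(t)$. Brouwer trees (in homotopy type theory): $\mathsf{Brw}$ is the quotient inductive-inductive type defined simultaneously with $\leq\, : \mathsf{Brw}\to\mathsf{Brw}\to\mathsf{hProp}$, $x<y := \mathsf{succ}\,x \leq y$; $\mathbb{N}\to_<\mathsf{Brw}$ is the type of sequences with $f(k)<f(k+1)$; constructors $\mathsf{zero}$, $\mathsf{succ}$, $\mathsf{limit} : (\mathbb{N}\to_<\mathsf{Brw})\to\mathsf{Brw}$, $\mathsf{bisim}$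 identifying $\mathsf{limit}\,f$ and $\mathsf{limit}\,g$ whenever $\forall k\exists n. f(k)\leq g(n)$ and $\forall k \exists n. g(k)\leq f(n)$, and set truncation; $\leq$ has constructors $\mathsf{zero}\leq x$, transitivity, $x\leq y\to\mathsf{succ}\,x\leq\mathsf{succ}\,y$, $x\leq f(k)\to x\leq\mathsf{limit}\,f$, $(\forall k. f(k)\leq x)\to \mathsf{limit}\,f\leq x$, and propositional truncation. Arithmetic on $\mathsf{Brw}$: $x+\mathsf{zero}:=x$, $x+\mathsf{succ}\,y := \mathsf{succ}(x+y)$, $x+\mathsf{limit}\,f := \mathsf{limit}(\lambda k. x+f(k))$; $\iota(0):=\mathsf{zero}$, $\iota(n+1):=\mathsf{succ}\,\iota(n)$, $\omega:=\mathsf{limit}\,\iota$; $x\cdot\mathsf{zero}:=\mathsf{zero}$, $x\cdot\mathsf{succ}\,y:=x\cdot y+x$, $x\cdot\mathsf{limit}\,f := \mathsf{zero}$ if $x=\mathsf{zero}$, else $\mathsf{limit}(\lambda k. x\cdot f(k))$; $\omega^{\mathsf{zero}}:=\mathsf{succ}\,\mathsf{zero}$, $\omega^{\mathsf{succ}\,y}:=\omega^y\cdot\omega$, $\omega^{\mathsf{limit}\,f}:=\mathsf{limit}(\lambda k.\omega^{f(k)})$. The map $\mathsf{CtoB}$ is defined by $\mathsf{CtoB}(0) := \mathsf{zero}$ and $\mathsf{CtoB}(\mathsf{node}(a,b)) := \omega^{\mathsf{CtoB}(a)} + \mathsf{CtoB}(b)$. -}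

module Defs where

open import Data.Nat using (ℕ; suc) renaming (zero to nzero)
open import Data.Product using (Σ; _,_; proj₁)
open import Data.Sum using (_⊎_)
open import Relation.Binary.PropositionalEquality using (_≡_)

data 𝒯 : Set where
  0𝒯   : 𝒯
  node : 𝒯 → 𝒯 → 𝒯

infix 4 _<ᵀ_ _≤ᵀ_

data _<ᵀ_ : 𝒯 → 𝒯 → Set where
  <₁ : ∀ {a b} → 0𝒯 <ᵀ node a b
  <₂ : ∀ {a b c d} → a <ᵀ c → node a b <ᵀ node c d
  <₃ : ∀ {a b d} → b <ᵀ d → node a b <ᵀ node a d

_≤ᵀ_ : 𝒯 → 𝒯 → Set
s ≤ᵀ t = (s <ᵀ t) ⊎ (s ≡ t)

left : 𝒯 → 𝒯
left 0𝒯 = 0𝒯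
left (node a _) = a

data isCNF : 𝒯 → Set where
  cnf0    : isCNF 0𝒯
  cnfnode : ∀ {s t} → isCNF s → isCNF t → left t ≤ᵀ s → isCNF (node s t)

Cnf : Set
Cnf = Σ 𝒯 isCNF

_<ᶜ_ : Cnf → Cnf → Set
a <ᶜ b = proj₁ a <ᵀ proj₁ b

_≤ᶜ_ : Cnf → Cnf → Set
a ≤ᶜ b = proj₁ a ≤ᵀ proj₁ b

-- Brouwer trees (inductive-inductive: no quotient
-- by bisim and no truncations, which plain Agda does not provide)

data Brw : Set
data _≤_ : Brw → Brw → Set

infix 4 _≤_ _<_

_<_ : Brw → Brw → Set

data Brw where
  zero  : Brw
  succ  : Brw → Brw
  limit : (f : ℕ → Brw) → (∀ k → succ (f k) ≤ f (suc k)) → Brw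

x < y = succ x ≤ y

data _≤_ where
  ≤-zero     : ∀ {x} → zero ≤ x
  ≤-trans    : ∀ {x y z} → x ≤ y → y ≤ z → x ≤ z
  ≤-succ     : ∀ {x y} → x ≤ y → succ x ≤ succ y
  ≤-cocone   : ∀ {x} f {p : ∀ k → succ (f k) ≤ f (suc k)} k → x ≤ f k → x ≤ limit f p
  ≤-limiting : ∀ f {p : ∀ k → succ (f k) ≤ f (suc k)} {x} → (∀ k → f k ≤ x) → limit f p ≤ x

≤-refl : ∀ x → x ≤ x
≤-refl zero = ≤-zero
≤-refl (succ x) = ≤-succ (≤-refl x)
≤-refl (limit f p) = ≤-limiting f (λ k → ≤-cocone f k (≤-refl (f k)))

x≤succx : ∀ x → x ≤ succ x
x≤succx zero = ≤-zero
x≤succx (succ x) = ≤-succ (x≤succx x)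
x≤succx (limit f p) =
  ≤-limiting f (λ k → ≤-trans (x≤succx (f k)) (≤-succ (≤-cocone f k (≤-refl (f k)))))

infixl 6 _+_
infixl 7 _·_

_+_ : Brw → Brw → Brw
+-mono : ∀ x {y z} → y ≤ z → x + y ≤ x + z
x≤x+ : ∀ x z → x ≤ x + z

x + zero = x
x + succ y = succ (x + y)
x + limit f p = limit (λ k → x + f k) (λ k → +-mono x (p k))

+-mono x (≤-zero {z}) = x≤x+ x z
+-mono x (≤-trans d e) = ≤-trans (+-mono x d) (+-mono x e)
+-mono x (≤-succ d) = ≤-succ (+-mono x d)
+-mono x (≤-cocone f k d) = ≤-cocone (λ k → x + f k) k (+-mono x d)
+-mono x (≤-limiting f h) = ≤-limiting (λ k → x + f k) (λ k → +-mono x (h k))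

x≤x+ x zero = ≤-refl x
x≤x+ x (succ z) = ≤-trans (x≤x+ x z) (x≤succx (x + z))
x≤x+ x (limit f p) = ≤-cocone (λ k → x + f k) 0 (x≤x+ x (f 0))

+-monoˡ : ∀ {a b} c → a ≤ b → a + c ≤ b + c
+-monoˡ zero d = d
+-monoˡ (succ c) d = ≤-succ (+-monoˡ c d)
+-monoˡ {a} {b} (limit f p) d =
  ≤-limiting (λ k → a + f k) (λ k → ≤-cocone (λ k → b + f k) k (+-monoˡ (f k) d))

<+pos : ∀ w {x} → zero < x → w < w + x
<+pos w d = +-mono w d

_·_ : Brw → Brw → Brw
·-mono : ∀ x {y z} → y ≤ z → x · y ≤ x · z
zero·≤ : ∀ y → zero · y ≤ zero
·-strict : ∀ x {y z} → zero < x → y < z → x · y < x · z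

x · zero = zero
x · succ y = x · y + x
zero · limit f p = zero
succ x · limit f p =
  limit (λ k → succ x · f k) (λ k → ·-strict (succ x) (≤-succ ≤-zero) (p k))
limit g q · limit f p =
  limit (λ k → limit g q · f k)
        (λ k → ·-strict (limit g q)
                  (≤-cocone g 1 (≤-trans (≤-succ ≤-zero) (q 0))) (p k))

zero·≤ zero = ≤-zero
zero·≤ (succ y) = zero·≤ y
zero·≤ (limit f p) = ≤-zero

·-strict x {y} pos d = ≤-trans (<+pos (x · y) pos) (·-mono x d)

·-mono x ≤-zero = ≤-zero
·-mono x (≤-trans d e) = ≤-trans (·-mono x d) (·-mono x e)
·-mono x {succ y} {succ z} (≤-succ d) = ≤-trans (+-monoˡ x (·-mono x d)) (≤-refl (x · z + x))
·-mono zero (≤-cocone f k d) = ≤-trans (·-mono zero d) (zero·≤ (f k))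
·-mono (succ x) (≤-cocone f k d) = ≤-cocone (λ k → succ x · f k) k (·-mono (succ x) d)
·-mono (limit g q) (≤-cocone f k d) = ≤-cocone (λ k → limit g q · f k) k (·-mono (limit g q) d)
·-mono zero (≤-limiting f h) = ≤-zero
·-mono (succ x) (≤-limiting f h) = ≤-limiting (λ k → succ x · f k) (λ k → ·-mono (succ x) (h k))
·-mono (limit g q) (≤-limiting f h) = ≤-limiting (λ k → limit g q · f k) (λ k → ·-mono (limit g q) (h k))

ι : ℕ → Brw
ι nzero = zero
ι (suc n) = succ (ι n)

ω : Brw
ω = limit ι (λ k → ≤-refl (succ (ι k)))

a≤0+a : ∀ a → a ≤ zero + a
a≤0+a zero = ≤-zero
a≤0+a (succ a) = ≤-succ (a≤0+a a)
a≤0+a (limit f p) = ≤-limiting f (λ k → ≤-cocone (λ k → zero + f k) k (a≤0+a (f k)))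

a<a·ω : ∀ a → zero < a → a < a · ω
a<a·ω zero pos = pos
a<a·ω (succ a) pos =
  ≤-cocone (λ k → succ a · ι k) 2
    (≤-trans (≤-succ (a≤0+a (succ a))) (<+pos (zero + succ a) pos))
a<a·ω (limit g q) pos =
  ≤-cocone (λ k → limit g q · ι k) 2
    (≤-trans (≤-succ (a≤0+a (limit g q))) (<+pos (zero + limit g q) pos))

≤zero·≤zero : ∀ {a} c → a ≤ zero → a · c ≤ zero
≤zero·≤zero zero d = ≤-zero
≤zero·≤zero {a} (succ c) d = ≤-trans (+-monoˡ a (≤zero·≤zero c d)) (≤-trans (+-mono zero d) (≤-refl zero))
≤zero·≤zero {zero} (limit f p) d = ≤-zero
≤zero·≤zero {succ a} (limit f p) d = ≤-limiting (λ k → succ a · f k) (λ k → ≤zero·≤zero (f k) d)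
≤zero·≤zero {limit g q} (limit f p) d = ≤-limiting (λ k → limit g q · f k) (λ k → ≤zero·≤zero (f k) d)

·ω-monoˡ : ∀ {a b} → a ≤ b → a · ω ≤ b · ω
·ω-monoˡ {zero} d = ≤-zero
·ω-monoˡ {succ a} {zero} d = ≤zero·≤zero ω d
·ω-monoˡ {succ a} {succ b} d =
  ≤-limiting (λ k → succ a · ι k) (λ k → ≤-cocone (λ k → succ b · ι k) k (·ι-monoˡ k d))
  where
  ·ι-monoˡ : ∀ {a b} k → a ≤ b → a · ι k ≤ b · ι k
  ·ι-monoˡ nzero d = ≤-zero
  ·ι-monoˡ {a} {b} (suc k) d = ≤-trans (+-monoˡ a (·ι-monoˡ k d)) (+-mono (b · ι k) d)
·ω-monoˡ {succ a} {limit g q} d =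
  ≤-limiting (λ k → succ a · ι k) (λ k → ≤-cocone (λ k → limit g q · ι k) k (·ι-monoˡ k d))
  where
  ·ι-monoˡ : ∀ {a b} k → a ≤ b → a · ι k ≤ b · ι k
  ·ι-monoˡ nzero d = ≤-zero
  ·ι-monoˡ {a} {b} (suc k) d = ≤-trans (+-monoˡ a (·ι-monoˡ k d)) (+-mono (b · ι k) d)
·ω-monoˡ {limit f p} {zero} d = ≤zero·≤zero ω d
·ω-monoˡ {limit f p} {succ b} d =
  ≤-limiting (λ k → limit f p · ι k) (λ k → ≤-cocone (λ k → succ b · ι k) k (·ι-monoˡ k d))
  where
  ·ι-monoˡ : ∀ {a b} k → a ≤ b → a · ι k ≤ b · ι k
  ·ι-monoˡ nzero d = ≤-zero
  ·ι-monoˡ {a} {b} (suc k) d = ≤-trans (+-monoˡ a (·ι-monoˡ k d)) (+-mono (b · ι k) d)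
·ω-monoˡ {limit f p} {limit g q} d =
  ≤-limiting (λ k → limit f p · ι k) (λ k → ≤-cocone (λ k → limit g q · ι k) k (·ι-monoˡ k d))
  where
  ·ι-monoˡ : ∀ {a b} k → a ≤ b → a · ι k ≤ b · ι k
  ·ι-monoˡ nzero d = ≤-zero
  ·ι-monoˡ {a} {b} (suc k) d = ≤-trans (+-monoˡ a (·ι-monoˡ k d)) (+-mono (b · ι k) d)

ω^_ : Brw → Brw
ω^-mono : ∀ {y z} → y ≤ z → ω^ y ≤ ω^ z
ω^-pos : ∀ y → zero < ω^ y

ω^ zero = succ zero
ω^ succ y = (ω^ y) · ω
ω^ limit f p = limit (λ k → ω^ f k)
  (λ k → ≤-trans (a<a·ω (ω^ f k) (ω^-pos (f k))) (ω^-mono (p k)))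

ω^-pos zero = ≤-refl (succ zero)
ω^-pos (succ y) = ≤-trans (ω^-pos y) (≤-trans (x≤succx (ω^ y)) (a<a·ω (ω^ y) (ω^-pos y)))
ω^-pos (limit f p) = ≤-cocone (λ k → ω^ f k) 0 (ω^-pos (f 0))

ω^-mono (≤-zero {z}) = ω^-pos z
ω^-mono (≤-trans d e) = ≤-trans (ω^-mono d) (ω^-mono e)
ω^-mono (≤-succ d) = ·ω-monoˡ (ω^-mono d)
ω^-mono (≤-cocone f k d) = ≤-cocone (λ k → ω^ f k) k (ω^-mono d)
ω^-mono (≤-limiting f h) = ≤-limiting (λ k → ω^ f k) (λ k → ω^-mono (h k))

CtoB-𝒯 : 𝒯 → Brw
CtoB-𝒯 0𝒯 = zero
CtoB-𝒯 (node a b) = (ω^ CtoB-𝒯 a) + CtoB-𝒯 b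

CtoB : Cnf → Brw
CtoB (t , _) = CtoB-𝒯 t

{-# OPTIONS --safe #-}
-- CtoB is strictly monotone: for a CNF node a b, the tail b is below ω^a · n for
-- some n, so CtoB (node a b) < ω^(a+1) ≤ ω^c whenever a < c.  The order on trees is
-- trichotomous and < on Brouwer trees is irreflexive, so a strictly monotone map
-- also reflects < and ≤.
module Submission where

open import Defs
open import Data.Nat using (suc)
open import Data.Empty using (⊥; ⊥-elim)
open import Data.Unit using (⊤; tt)
open import Data.Product using (_×_; _,_; ∃-syntax)
open import Data.Sum using (_⊎_; inj₁; inj₂)
open import Function using (_⇔_; mk⇔)
open import Relation.Nullary using (¬_)
open import Relation.Binary.PropositionalEquality using (_≡_; refl)

-- _≤_ cannot be inverted because of its ≤-trans constructor.  The structurally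
-- recursive _≤ₛ_ validates every constructor of _≤_ and is irreflexive.

_≤ₛ_ : Brw → Brw → Set
_<ₛ_ : Brw → Brw → Set
zero      ≤ₛ y = ⊤
succ x    ≤ₛ y = x <ₛ y
limit f _ ≤ₛ y = ∀ k → f k ≤ₛ y
x <ₛ zero      = ⊥
x <ₛ succ y    = x ≤ₛ y
x <ₛ limit g _ = ∃[ k ] x <ₛ g k

≤ₛ-cocone : ∀ x g q k → x ≤ₛ g k → x ≤ₛ limit g q
≤ₛ-cocone zero        g q k _ = tt
≤ₛ-cocone (succ x)    g q k h = k , h
≤ₛ-cocone (limit f _) g q k h = λ j → ≤ₛ-cocone (f j) g q k (h j)

≤ₛ-refl : ∀ x → x ≤ₛ x
≤ₛ-refl zero        = tt
≤ₛ-refl (succ x)    = ≤ₛ-refl x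
≤ₛ-refl (limit f p) = λ k → ≤ₛ-cocone (f k) f p k (≤ₛ-refl (f k))

<ₛ⇒≤ₛ : ∀ x y → x <ₛ y → x ≤ₛ y
≤ₛ-succʳ : ∀ x y → x ≤ₛ y → x ≤ₛ succ y
<ₛ⇒≤ₛ x (succ y)    h       = ≤ₛ-succʳ x y h
<ₛ⇒≤ₛ x (limit g q) (k , h) = ≤ₛ-cocone x g q k (<ₛ⇒≤ₛ x (g k) h)
≤ₛ-succʳ zero        y _ = tt
≤ₛ-succʳ (succ x)    y h = <ₛ⇒≤ₛ x y h
≤ₛ-succʳ (limit f _) y h = λ k → ≤ₛ-succʳ (f k) y (h k)

≤ₛ-trans : ∀ x y z → x ≤ₛ y → y ≤ₛ z → x ≤ₛ z
<ₛ-≤ₛ-trans : ∀ x y z → x <ₛ y → y ≤ₛ z → x <ₛ z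
≤ₛ-<ₛ-trans : ∀ x y z → x ≤ₛ y → y <ₛ z → x <ₛ z
≤ₛ-trans zero        y z _ _ = tt
≤ₛ-trans (succ x)    y z h i = <ₛ-≤ₛ-trans x y z h i
≤ₛ-trans (limit f _) y z h i = λ k → ≤ₛ-trans (f k) y z (h k) i
<ₛ-≤ₛ-trans x (succ y)    z h       i = ≤ₛ-<ₛ-trans x y z h i
<ₛ-≤ₛ-trans x (limit g _) z (k , h) i = <ₛ-≤ₛ-trans x (g k) z h (i k)
≤ₛ-<ₛ-trans x y (succ z)    h i       = ≤ₛ-trans x y z h i
≤ₛ-<ₛ-trans x y (limit g _) h (k , i) = k , ≤ₛ-<ₛ-trans x y (g k) h i

<ₛ-irrefl : ∀ x → ¬ (x <ₛ x)
<ₛ-irrefl (succ x)    h       = <ₛ-irrefl x h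
<ₛ-irrefl (limit f p) (k , h) =
  <ₛ-irrefl (f k) (≤ₛ-<ₛ-trans (f k) (limit f p) (f k) (≤ₛ-cocone (f k) f p k (≤ₛ-refl (f k))) h)

≤⇒≤ₛ : ∀ {x y} → x ≤ y → x ≤ₛ y
≤⇒≤ₛ ≤-zero                    = tt
≤⇒≤ₛ (≤-trans {x} {y} {z} d e) = ≤ₛ-trans x y z (≤⇒≤ₛ d) (≤⇒≤ₛ e)
≤⇒≤ₛ (≤-succ d)                = ≤⇒≤ₛ d
≤⇒≤ₛ (≤-cocone {x} f {p} k d)  = ≤ₛ-cocone x f p k (≤⇒≤ₛ d)
≤⇒≤ₛ (≤-limiting f d)          = λ k → ≤⇒≤ₛ (d k)

<-irrefl : ∀ x → ¬ (x < x)
<-irrefl x d = <ₛ-irrefl x (≤⇒≤ₛ d)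

<⇒≤ : ∀ {x y} → x < y → x ≤ y
<⇒≤ {x} d = ≤-trans (x≤succx x) d

<⇒≱ : ∀ {x y} → x < y → ¬ (y ≤ x)
<⇒≱ {x} d e = <-irrefl x (≤-trans d e)

+-assoc-≤ : ∀ x y z → x + (y + z) ≤ (x + y) + z
+-assoc-≤ x y zero        = ≤-refl (x + y)
+-assoc-≤ x y (succ z)    = ≤-succ (+-assoc-≤ x y z)
+-assoc-≤ x y (limit f _) =
  ≤-limiting (λ k → x + (y + f k)) (λ k → ≤-cocone (λ k → (x + y) + f k) k (+-assoc-≤ x y (f k)))

+·ι≤·ι-suc : ∀ x n → x + x · ι n ≤ x · ι (suc n)
+·ι≤·ι-suc x 0       = a≤0+a x
+·ι≤·ι-suc x (suc n) = ≤-trans (+-assoc-≤ x (x · ι n) x) (+-monoˡ x (+·ι≤·ι-suc x n))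

·ι<·ω : ∀ x n → zero < x → x · ι n < x · ω
·ι<·ω x n pos = ≤-trans (<+pos (x · ι n) pos) (·-mono x (≤-cocone ι (suc n) (≤-refl (ι (suc n)))))

<ᵀ-trans : ∀ {a b c} → a <ᵀ b → b <ᵀ c → a <ᵀ c
<ᵀ-trans <₁     (<₂ _) = <₁
<ᵀ-trans <₁     (<₃ _) = <₁
<ᵀ-trans (<₂ p) (<₂ q) = <₂ (<ᵀ-trans p q)
<ᵀ-trans (<₂ p) (<₃ _) = <₂ p
<ᵀ-trans (<₃ _) (<₂ q) = <₂ q
<ᵀ-trans (<₃ p) (<₃ q) = <₃ (<ᵀ-trans p q)

≤ᵀ-trans : ∀ {a b c} → a ≤ᵀ b → b ≤ᵀ c → a ≤ᵀ c
≤ᵀ-trans (inj₁ p)    (inj₁ q)    = inj₁ (<ᵀ-trans p q)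
≤ᵀ-trans (inj₁ p)    (inj₂ refl) = inj₁ p
≤ᵀ-trans (inj₂ refl) q           = q

<ᵀ-trichotomy : ∀ a b → a <ᵀ b ⊎ a ≡ b ⊎ b <ᵀ a
<ᵀ-trichotomy 0𝒯        0𝒯         = inj₂ (inj₁ refl)
<ᵀ-trichotomy 0𝒯        (node _ _) = inj₁ <₁
<ᵀ-trichotomy (node _ _) 0𝒯        = inj₂ (inj₂ <₁)
<ᵀ-trichotomy (node a b) (node c d) with <ᵀ-trichotomy a c
... | inj₁ p           = inj₁ (<₂ p)
... | inj₂ (inj₂ p)    = inj₂ (inj₂ (<₂ p))
... | inj₂ (inj₁ refl) with <ᵀ-trichotomy b d
...   | inj₁ p           = inj₁ (<₃ p)
...   | inj₂ (inj₂ p)    = inj₂ (inj₂ (<₃ p))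
...   | inj₂ (inj₁ refl) = inj₂ (inj₁ refl)

CtoB-𝒯-mono-< : ∀ {s t} → isCNF s → isCNF t → s <ᵀ t → CtoB-𝒯 s < CtoB-𝒯 t
CtoB-𝒯-mono-≤ : ∀ {s t} → isCNF s → isCNF t → s ≤ᵀ t → CtoB-𝒯 s ≤ CtoB-𝒯 t
CtoB-𝒯-<-ω^-suc : ∀ {t a} → isCNF t → isCNF a → left t ≤ᵀ a → CtoB-𝒯 t < ω^ succ (CtoB-𝒯 a)
CtoB-𝒯-≤-ω^·ι : ∀ {t a} → isCNF t → isCNF a → left t ≤ᵀ a → ∃[ n ] CtoB-𝒯 t ≤ ω^ CtoB-𝒯 a · ι n

CtoB-𝒯-mono-< {t = node c d} cnf0 _ <₁ = ≤-trans (ω^-pos (CtoB-𝒯 c)) (x≤x+ (ω^ CtoB-𝒯 c) (CtoB-𝒯 d))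
CtoB-𝒯-mono-< {t = node c d} s@(cnfnode ca _ _) (cnfnode cc _ _) (<₂ a<c) =
  ≤-trans (CtoB-𝒯-<-ω^-suc s ca (inj₂ refl))
          (≤-trans (ω^-mono (CtoB-𝒯-mono-< ca cc a<c)) (x≤x+ (ω^ CtoB-𝒯 c) (CtoB-𝒯 d)))
CtoB-𝒯-mono-< {node a _} (cnfnode _ cb _) (cnfnode _ cd _) (<₃ b<d) =
  +-mono (ω^ CtoB-𝒯 a) (CtoB-𝒯-mono-< cb cd b<d)

CtoB-𝒯-mono-≤ cs ct (inj₁ s<t)    = <⇒≤ (CtoB-𝒯-mono-< cs ct s<t)
CtoB-𝒯-mono-≤ {s} _ _ (inj₂ refl) = ≤-refl (CtoB-𝒯 s)

CtoB-𝒯-<-ω^-suc {a = a} ct ca l with CtoB-𝒯-≤-ω^·ι ct ca l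
... | n , t≤ = ≤-trans (≤-succ t≤) (·ι<·ω (ω^ CtoB-𝒯 a) n (ω^-pos (CtoB-𝒯 a)))

CtoB-𝒯-≤-ω^·ι cnf0 _ _ = 0 , ≤-zero
CtoB-𝒯-≤-ω^·ι {node a′ b} {a} (cnfnode ca′ cb lb≤a′) ca a′≤a with CtoB-𝒯-≤-ω^·ι cb ca (≤ᵀ-trans lb≤a′ a′≤a)
... | n , b≤ = suc n ,
  ≤-trans (+-monoˡ (CtoB-𝒯 b) (ω^-mono (CtoB-𝒯-mono-≤ ca′ ca a′≤a)))
          (≤-trans (+-mono (ω^ CtoB-𝒯 a) b≤) (+·ι≤·ι-suc (ω^ CtoB-𝒯 a) n))

CtoB-𝒯-cancel-< : ∀ {s t} → isCNF s → isCNF t → CtoB-𝒯 s < CtoB-𝒯 t → s <ᵀ t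
CtoB-𝒯-cancel-< {s} {t} cs ct h with <ᵀ-trichotomy s t
... | inj₁ s<t         = s<t
... | inj₂ (inj₁ refl) = ⊥-elim (<-irrefl (CtoB-𝒯 s) h)
... | inj₂ (inj₂ t<s)  = ⊥-elim (<⇒≱ (CtoB-𝒯-mono-< ct cs t<s) (<⇒≤ h))

CtoB-𝒯-cancel-≤ : ∀ {s t} → isCNF s → isCNF t → CtoB-𝒯 s ≤ CtoB-𝒯 t → s ≤ᵀ t
CtoB-𝒯-cancel-≤ {s} {t} cs ct h with <ᵀ-trichotomy s t
... | inj₁ s<t        = inj₁ s<t
... | inj₂ (inj₁ s≡t) = inj₂ s≡t
... | inj₂ (inj₂ t<s) = ⊥-elim (<⇒≱ (CtoB-𝒯-mono-< ct cs t<s) h)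

theorem8p2 : (a b : Cnf) →
    ((a <ᶜ b) ⇔ (CtoB a < CtoB b)) × ((a ≤ᶜ b) ⇔ (CtoB a ≤ CtoB b))
theorem8p2 (_ , ca) (_ , cb) =
  mk⇔ (CtoB-𝒯-mono-< ca cb) (CtoB-𝒯-cancel-< ca cb) ,
  mk⇔ (CtoB-𝒯-mono-≤ ca cb) (CtoB-𝒯-cancel-≤ ca cb)
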